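{- If $M$ is a $\lambda$-term in $\beta$-normal form, then $\mathtt{InferStrong}(M)$ terminates without performing any expansion.
   Context: $\lambda$-terms: $M,N::=x\mid\lambda x.M\mid MN$; $\beta$-normal forms contain no subterm $(\lambda x.P)Q$. Pre-types: ${\tt A}::={\tt a}\mid\sigma\to{\tt A}$, ${\tt a}$ a pre-type variable, $\sigma=\langle{\tt A}_1,\dots,{\tt A}_n\rangle$ ($n\ge0$) an ordered list; $|\sigma|$ length, $\cdot$ concatenation; pre-type environments map variables to lists, with pointwise concatenation. Disjoint = no common pre-type variable; fresh = occurring nowhere else. Strong pseudo-derivation $(\Pi,E_\Pi)$ for $M$: (var) $x:\langle{\tt a}\rangle\vdash_{\tt p}x:{\tt a}$, $E=\emptyset$; (many) from pairwise disjoint $\Sigma_i\triangleright\mathtt\Gamma_i\vdash_{\tt p}M:{\tt a}_i$ ($n\ge1$) infer $\mathtt\Gamma_1\cdot\ldots\cdot\mathtt\Gamma_n\vdash_{\tt p}M:\langle{\tt a}_1,\dots,{\tt a}_n\rangle$, $E=\bigcup E_{\Sigma_i}$; (app) from disjoint $\Sigma_1\triangleright\mathtt\Gamma\vdash_{\tt p}M:{\tt a}$, $\Sigma_2\triangleright\mathtt\Delta\vdash_{\tt p}N:\langle{\tt b}_1,\dots,{\tt b}_n\rangle$, ${\tt c}$ fresh, infer $\mathtt\Gamma\cdot\mathtt\Delta\vdash_{\tt p}MN:{\tt c}$, $E=E_{\Sigma_1}\cup E_{\Sigma_2}\cup\{{\tt a}\doteq\langle{\tt b}_1,\dots,{\tt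 b}_n\rangle\to{\tt c}\}$; (abs-I) from $\Sigma\triangleright\mathtt\Gamma,x:\sigma\vdash_{\tt p}M:{\tt a}$, $\sigma\neq\langle\rangle$, ${\tt b}$ fresh, infer $\mathtt\Gamma\vdash_{\tt p}\lambda x.M:{\tt b}$, $E=E_\Sigma\cup\{{\tt b}\doteq\sigma\to{\tt a}\}$; (abs-K) from $\Sigma\triangleright\mathtt\Gamma\vdash_{\tt p}M:{\tt a}$, $x\notin\mathrm{dom}(\mathtt\Gamma)$, ${\tt b},{\tt c}$ fresh, infer $\mathtt\Gamma\vdash_{\tt p}\lambda x.M:{\tt c}$, $E=E_\Sigma\cup\{{\tt c}\doteq\langle{\tt b}\rangle\to{\tt a}\}$. Modulo renaming; $\mathrm{PD}^{\mathsf s}_{\min}(M)$ has $n=1$ in all (many) rules. Expansion $\mathsf{Exp}(\sigma,n,\Pi)$ ($\sigma\neq\langle\rangle$, $n\ge1$): if $\sigma=\langle{\tt a}_1,\dots,{\tt a}_m\rangle$ is the conclusion list of a (many) rule of $\Pi$ with subject $N$, replace the subtree there by a (many) rule whose $m+n$ premises are fresh pairwise disjoint copies $\vdash_{\tt p}N:{\tt a}_i$ of $\mathrm{PD}^{\mathsf s}_{\min}(N)$, and recompute the equation set; else unchanged. Unification rules $\to_{\mathsf u}$ on sets of equations: (erase) remove ${\tt A}\doteq{\tt A}$; (swap) $\sigma\to{\tt A}\doteq{\tt a}$ becomes ${\tt a}\doteq\sigma\to{\tt A}$; (arrow) $\sigma\to{\tt A}\doteq\tau\to{\tt B}$ becomes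 $\sigma\doteq\tau,{\tt A}\doteq{\tt B}$; (list) $\langle{\tt A}_1..{\tt A}_n\rangle\doteq\langle{\tt B}_1..{\tt B}_n\rangle$ becomes ${\tt A}_i\doteq{\tt B}_i$; (subs) given ${\tt a}\doteq{\tt A}$ with ${\tt a}\notin\mathsf{Var}({\tt A})$ and ${\tt a}$ occurring in the rest $S$, replace all occurrences of ${\tt a}$ in $S$ by ${\tt A}$. $\to_{\mathsf o}$: same, with (subs) restricted to the case ${\tt a}$ occurs in $S$ outside a list and replacing only occurrences not inside lists. $\mathrm{nf}_{\mathsf u},\mathrm{nf}_{\mathsf o}$ denote the unique normal forms. Blocked form: contains $\sigma\doteq\tau$ with $|\sigma|\neq|\tau|$. For a set in solved form $\{{\tt a}_i\doteq{\tt B}_i\}$, $\mathrm{mgu}$ maps ${\tt a}_i\mapsto{\tt B}_i$. Algorithm $\mathtt{InferStrong}(M)$ (non-deterministic): $(\Pi,E):=\mathrm{PD}^{\mathsf s}_{\min}(M)$; $E:=\mathrm{nf}_{\mathsf o}(E)$; while $E$ is in blocked form: choose $\sigma\doteq\tau\in E$ with $|\sigma|\neq|\tau|$; if $|\sigma|>|\tau|$ set $(\Pi,E):=\mathsf{Exp}(\tau,|\sigma|-|\tau|,\Pi)$, else $(\Pi,E):=\mathsf{Exp}(\sigma,|\tau|-|\sigma|,\Pi)$; then $E:=\mathrm{nf}_{\mathsf o}(E)$. After the loop: $E:=\mathrm{nf}_{\mathsf u}(E)$, $\psi:=\mathrm{mgu}(E)$, return $(\Pi,\psi)$. The algorithm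 is said to terminate on $M$ if some execution path terminates. -}

module Defs where

open import Data.Nat using (ℕ; zero; suc; _+_; _≟_)
open import Data.List using (List; []; _∷_; _++_; map; length; zipWith; [_])
open import Data.List.Relation.Unary.Any using (Any)
open import Data.List.Relation.Unary.All using (All)
open import Data.List.Relation.Unary.Unique.Propositional using (Unique)
open import Data.Product using (Σ; _×_; _,_; proj₁; proj₂; ∃-syntax)
open import Data.Sum using (_⊎_)
open import Data.Empty using (⊥)
open import Relation.Nullary using (¬_; yes; no)
open import Relation.Binary.PropositionalEquality using (_≡_; _≢_)

data Term : Set where
  var : ℕ → Term
  lam : ℕ → Term → Term
  app : Term → Term → Term

data HasRedex : Term → Set where
  redex : ∀ {x P Q} → HasRedex (app (lam x P) Q)
  inLam : ∀ {x M} → HasRedex M → HasRedex (lam x M)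
  inFun : ∀ {M N} → HasRedex M → HasRedex (app M N)
  inArg : ∀ {M N} → HasRedex N → HasRedex (app M N)

BetaNormal : Term → Set
BetaNormal M = ¬ HasRedex M

infixr 6 _⇒_
data PT : Set where
  tv  : ℕ → PT
  _⇒_ : List PT → PT → PT

data _∈V_ (a : ℕ) : PT → Set where
  here : a ∈V tv a
  dom  : ∀ {σ B} → Any (a ∈V_) σ → a ∈V (σ ⇒ B)
  cod  : ∀ {σ B} → a ∈V B → a ∈V (σ ⇒ B)

data _∈O_ (a : ℕ) : PT → Set where
  here : a ∈O tv a
  cod  : ∀ {σ B} → a ∈O B → a ∈O (σ ⇒ B)

mutual
  subst : ℕ → PT → PT → PT
  subst a A (tv b) with a ≟ b
  ... | yes _ = A
  ... | no  _ = tv b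
  subst a A (σ ⇒ B) = substL a A σ ⇒ subst a A B

  substL : ℕ → PT → List PT → List PT
  substL a A []       = []
  substL a A (B ∷ σ)  = subst a A B ∷ substL a A σ

substO : ℕ → PT → PT → PT
substO a A (tv b) with a ≟ b
... | yes _ = A
... | no  _ = tv b
substO a A (σ ⇒ B) = σ ⇒ substO a A B

infix 4 _≐_ _≐ₗ_
data Eqn : Set where
  _≐_  : PT → PT → Eqn
  _≐ₗ_ : List PT → List PT → Eqn

_∈E_ : ℕ → Eqn → Set
a ∈E (A ≐ B)  = a ∈V A ⊎ a ∈V B
a ∈E (σ ≐ₗ τ) = Any (a ∈V_) σ ⊎ Any (a ∈V_) τ

_∈OE_ : ℕ → Eqn → Set
a ∈OE (A ≐ B)  = a ∈O A ⊎ a ∈O B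
a ∈OE (σ ≐ₗ τ) = ⊥

substEq : ℕ → PT → Eqn → Eqn
substEq a A (B ≐ C)  = subst a A B ≐ subst a A C
substEq a A (σ ≐ₗ τ) = substL a A σ ≐ₗ substL a A τ

substOEq : ℕ → PT → Eqn → Eqn
substOEq a A (B ≐ C)  = substO a A B ≐ substO a A C
substOEq a A (σ ≐ₗ τ) = σ ≐ₗ τ

-- Unification rules (sets of equations represented as lists; a rule
-- acts on an equation at any position  xs ++ e ∷ ys)

infix 4 _→u_ _→o_
data _→u_ : List Eqn → List Eqn → Set where
  erase : ∀ xs ys A → (xs ++ (A ≐ A) ∷ ys) →u (xs ++ ys)
  swap  : ∀ xs ys σ A a →
          (xs ++ (σ ⇒ A ≐ tv a) ∷ ys) →u (xs ++ (tv a ≐ σ ⇒ A) ∷ ys)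
  arrow : ∀ xs ys σ A τ B →
          (xs ++ (σ ⇒ A ≐ τ ⇒ B) ∷ ys) →u (xs ++ (σ ≐ₗ τ) ∷ (A ≐ B) ∷ ys)
  list  : ∀ xs ys σ τ → length σ ≡ length τ →
          (xs ++ (σ ≐ₗ τ) ∷ ys) →u (xs ++ zipWith _≐_ σ τ ++ ys)
  subs  : ∀ xs ys a A → ¬ (a ∈V A) → Any (a ∈E_) (xs ++ ys) →
          (xs ++ (tv a ≐ A) ∷ ys) →u
          (map (substEq a A) xs ++ (tv a ≐ A) ∷ map (substEq a A) ys)

data _→o_ : List Eqn → List Eqn → Set where
  erase : ∀ xs ys A → (xs ++ (A ≐ A) ∷ ys) →o (xs ++ ys)
  swap  : ∀ xs ys σ A a →
          (xs ++ (σ ⇒ A ≐ tv a) ∷ ys) →o (xs ++ (tv a ≐ σ ⇒ A) ∷ ys)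
  arrow : ∀ xs ys σ A τ B →
          (xs ++ (σ ⇒ A ≐ τ ⇒ B) ∷ ys) →o (xs ++ (σ ≐ₗ τ) ∷ (A ≐ B) ∷ ys)
  list  : ∀ xs ys σ τ → length σ ≡ length τ →
          (xs ++ (σ ≐ₗ τ) ∷ ys) →o (xs ++ zipWith _≐_ σ τ ++ ys)
  subs  : ∀ xs ys a A → ¬ (a ∈V A) → Any (a ∈OE_) (xs ++ ys) →
          (xs ++ (tv a ≐ A) ∷ ys) →o
          (map (substOEq a A) xs ++ (tv a ≐ A) ∷ map (substOEq a A) ys)

IrreducibleU : List Eqn → Set
IrreducibleU E = ∀ E' → ¬ (E →u E')

IrreducibleO : List Eqn → Set
IrreducibleO E = ∀ E' → ¬ (E →o E')

Blocked : List Eqn → Set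
Blocked E = Any (λ e → ∃[ σ ] ∃[ τ ] (e ≡ (σ ≐ₗ τ) × length σ ≢ length τ)) E

Solved : List Eqn → Set
Solved E = Σ (List (ℕ × PT)) λ ps →
  (E ≡ map (λ p → tv (proj₁ p) ≐ proj₂ p) ps) ×
  Unique (map proj₁ ps) ×
  All (λ p → All (λ q → ¬ (proj₁ p ∈V proj₂ q)) ps) ps

-- Environments are functions from term variables to lists of pre-types
-- (empty list = not in the domain).  Fresh pre-type variables are drawn
-- from a counter, which guarantees the disjointness/freshness conditions.

Env : Set
Env = ℕ → List PT

_·_ : Env → Env → Env
(Γ · Δ) y = Γ y ++ Δ y

remove : ℕ → Env → Env
remove x Γ y with x ≟ y
... | yes _ = []
... | no  _ = Γ y

record PDResult : Set where
  constructor result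
  field
    typ   : ℕ          -- the pre-type variable a in  Γ ⊢p M : a
    env   : Env
    eqns  : List Eqn
    next  : ℕ

open PDResult

-- pdmin M n : minimal strong pseudo-derivation of M using pre-type
-- variables ≥ n ((many) rules always have exactly one premise)
pdmin : Term → ℕ → PDResult
pdmin (var x) n = result n env₀ [] (suc n)
  where
  env₀ : Env
  env₀ y with x ≟ y
  ... | yes _ = [ tv n ]
  ... | no  _ = []
pdmin (app M N) n =
  let r₁ = pdmin M n
      r₂ = pdmin N (next r₁)
      c  = next r₂
  in result c (env r₁ · env r₂)
            (eqns r₁ ++ eqns r₂ ++ [ tv (typ r₁) ≐ [ tv (typ r₂) ] ⇒ tv c ])
            (suc c)
-- (abs-I) if x is in the domain of the environment, (abs-K) otherwise
pdmin (lam x M) n = absCase (env r x)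
  where
  r = pdmin M n
  absCase : List PT → PDResult
  absCase [] = result (suc (next r)) (env r)
                 (eqns r ++ [ tv (suc (next r)) ≐ [ tv (next r) ] ⇒ tv (typ r) ])
                 (suc (suc (next r)))
  absCase σ@(_ ∷ _) = result (next r) (remove x (env r))
                 (eqns r ++ [ tv (next r) ≐ σ ⇒ tv (typ r) ])
                 (suc (next r))

initEqns : Term → List Eqn
initEqns M = eqns (pdmin M 0)

-- For β-normal M every equation of PD^s_min(M) has the form a ≐ B, and these
-- bindings form a triangular system.  Left-hand sides are pairwise distinct: they
-- are the types of abstractions and of terms in function position, and a term is
-- both only in a redex.  The system is acyclic: in (app) the variables of the
-- function are ranked above all those of the argument, in (abs) the fresh type
-- variable is ranked above everything, and then right-hand sides rank strictly
-- below left-hand sides.  A triangular system is solved by eliminating its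
-- left-hand variables one at a time with (subs): acyclicity gives a ∉ B, so the
-- rule applies, and substituting B never reintroduces a variable already
-- eliminated.  Done with →o this reaches an →o-normal form that still consists of
-- bindings, so has no list equation and is not blocked; done again with →u it
-- reaches a solved form.

module Submission where

open import Defs
open import Data.Nat using (ℕ; suc; _+_; _≤_; _<_; _≟_; _<?_; z≤n; s≤s)
open import Data.Nat.Properties
  using (≤-refl; ≤-trans; <⇒≤; <⇒≢; <-irrefl; <-trans; ≤-<-trans; <-≤-trans; m<n⇒m<1+n; n<1+n; n≤1+n; m≤m+n; +-monoʳ-<; module ≤-Reasoning)
open import Data.List using (List; []; _∷_; _++_; map; [_])
open import Data.List.Properties using (map-++; ∷-injective)
open import Data.List.Membership.Propositional using (_∈_; find; lose)
open import Data.List.Membership.Propositional.Properties using (∈-map⁺; ∈-map⁻; ∈-++⁺ˡ; ∈-++⁺ʳ; ∈-++⁻; ∈-insert; ∈-∃++)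
open import Data.List.Relation.Binary.Subset.Propositional.Properties using (++⁺ʳ; xs⊆x∷xs)
open import Data.List.Relation.Unary.Any as Any using (Any; here; there; any?)
import Data.List.Relation.Unary.Any.Properties as Any
open import Data.List.Relation.Unary.All as All using (All; []; _∷_)
import Data.List.Relation.Unary.All.Properties as All
open import Data.List.Relation.Unary.Unique.Propositional using (Unique)
open import Data.List.Relation.Unary.AllPairs using ([]; _∷_)
import Data.List.Relation.Unary.Unique.Propositional.Properties as Unique
open import Data.Product using (Σ; ∃-syntax; _×_; _,_; proj₁; proj₂; map₁; map₂)
open import Data.Sum using (_⊎_; inj₁; inj₂; [_,_]′)
import Data.Sum as Sum
open import Data.Empty using (⊥; ⊥-elim)
open import Data.Unit using (⊤; tt)
open import Function using (_∘_; id)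
open import Relation.Nullary using (¬_; Dec; yes; no)
open import Relation.Nullary.Decidable using (map′; _⊎-dec_)
import Relation.Binary.PropositionalEquality as ≡
open ≡ using (_≡_; _≢_; refl; sym; trans; cong; cong₂; ≢-sym; module ≡-Reasoning)
open import Relation.Binary.Construct.Closure.ReflexiveTransitive using (Star; ε; _◅_)

open PDResult

mutual
  _∈V?_ : ∀ a A → Dec (a ∈V A)
  a ∈V? tv b = map′ (λ { refl → here }) (λ { here → refl }) (a ≟ b)
  a ∈V? (σ ⇒ B) =
    map′ [ dom , cod ]′ (λ { (dom p) → inj₁ p ; (cod q) → inj₂ q }) (a ∈Vs? σ ⊎-dec a ∈V? B)

  _∈Vs?_ : ∀ a σ → Dec (Any (a ∈V_) σ)
  a ∈Vs? [] = no λ ()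
  a ∈Vs? (A ∷ σ) =
    map′ [ here , there ]′ (λ { (here p) → inj₁ p ; (there q) → inj₂ q }) (a ∈V? A ⊎-dec a ∈Vs? σ)

_∈O?_ : ∀ a A → Dec (a ∈O A)
a ∈O? tv b = map′ (λ { refl → here }) (λ { here → refl }) (a ≟ b)
a ∈O? (σ ⇒ B) = map′ cod (λ { (cod q) → q }) (a ∈O? B)

∈O⇒∈V : ∀ {a A} → a ∈O A → a ∈V A
∈O⇒∈V here    = here
∈O⇒∈V (cod q) = cod (∈O⇒∈V q)

subst-tv : ∀ {a c} B → a ≢ c → subst a B (tv c) ≡ tv c
subst-tv {a} {c} B a≢c with a ≟ c
... | yes a≡c = ⊥-elim (a≢c a≡c)
... | no _    = refl

substO-tv : ∀ {a c} B → a ≢ c → substO a B (tv c) ≡ tv c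
substO-tv {a} {c} B a≢c with a ≟ c
... | yes a≡c = ⊥-elim (a≢c a≡c)
... | no _    = refl

mutual
  ∈V-subst⁻ : ∀ {a B b} C → b ∈V subst a B C → (b ≢ a × b ∈V C) ⊎ (a ∈V C × b ∈V B)
  ∈V-subst⁻ {a} (tv c) h with a ≟ c
  ∈V-subst⁻ (tv c) h    | yes refl = inj₂ (here , h)
  ∈V-subst⁻ (tv c) here | no a≢c   = inj₁ (≢-sym a≢c , here)
  ∈V-subst⁻ (σ ⇒ C) (dom p) = Sum.map (map₂ dom) (map₁ dom) (∈Vs-subst⁻ σ p)
  ∈V-subst⁻ (σ ⇒ C) (cod q) = Sum.map (map₂ cod) (map₁ cod) (∈V-subst⁻ C q)

  ∈Vs-subst⁻ : ∀ {a B b} σ → Any (b ∈V_) (substL a B σ) →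
               (b ≢ a × Any (b ∈V_) σ) ⊎ (Any (a ∈V_) σ × b ∈V B)
  ∈Vs-subst⁻ (A ∷ σ) (here p)  = Sum.map (map₂ here) (map₁ here) (∈V-subst⁻ A p)
  ∈Vs-subst⁻ (A ∷ σ) (there q) = Sum.map (map₂ there) (map₁ there) (∈Vs-subst⁻ σ q)

∈V-substO⁻ : ∀ {a B b} C → b ∈V substO a B C → b ∈V C ⊎ (a ∈V C × b ∈V B)
∈V-substO⁻ {a} (tv c) h with a ≟ c
... | yes refl = inj₂ (here , h)
... | no _     = inj₁ h
∈V-substO⁻ (σ ⇒ C) (dom p) = inj₁ (dom p)
∈V-substO⁻ (σ ⇒ C) (cod q) = Sum.map cod (map₁ cod) (∈V-substO⁻ C q)

∈O-substO⁻ : ∀ {a B b} C → b ∈O substO a B C → (b ≢ a × b ∈O C) ⊎ b ∈O B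
∈O-substO⁻ {a} (tv c) h with a ≟ c
∈O-substO⁻ (tv c) h    | yes refl = inj₂ h
∈O-substO⁻ (tv c) here | no a≢c   = inj₁ (≢-sym a≢c , here)
∈O-substO⁻ (σ ⇒ C) (cod q) = Sum.map₁ (map₂ cod) (∈O-substO⁻ C q)

Binding : Set
Binding = ℕ × PT

toEq : Binding → Eqn
toEq (a , B) = tv a ≐ B

Distinct : List Binding → Set
Distinct ps = Unique (map proj₁ ps)

Ranked : (ℕ → ℕ) → List Binding → Set
Ranked rk ps = ∀ {p} → p ∈ ps → ∀ {b} → b ∈V proj₂ p → rk b < rk (proj₁ p)

ranked⇒∉rhs : ∀ {rk ps p} → Ranked rk ps → p ∈ ps → ¬ (proj₁ p ∈V proj₂ p)
ranked⇒∉rhs ranked p∈ a∈ = <-irrefl refl (ranked p∈ a∈)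

map-≡-++-∷⁻ : ∀ {A B : Set} (f : A → B) xs {ys e zs} → map f xs ≡ ys ++ e ∷ zs →
  ∃[ xs₁ ] ∃[ x ] ∃[ xs₂ ] xs ≡ xs₁ ++ x ∷ xs₂ × ys ≡ map f xs₁ × e ≡ f x × zs ≡ map f xs₂
map-≡-++-∷⁻ f (x ∷ xs) {[]} eq with ∷-injective eq
... | refl , refl = [] , x , xs , refl , refl , refl , refl
map-≡-++-∷⁻ f (x ∷ xs) {_ ∷ ys} eq with ∷-injective eq
... | refl , eq′ with map-≡-++-∷⁻ f xs {ys} eq′
...   | xs₁ , x′ , xs₂ , refl , refl , refl , refl = x ∷ xs₁ , x′ , xs₂ , refl , refl , refl , refl

∈-map-++-∷⁻ : ∀ {A : Set} (f : A → A) xs {p ys q} → q ∈ map f xs ++ p ∷ map f ys →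
  q ≡ p ⊎ ∃[ r ] r ∈ xs ++ p ∷ ys × q ≡ f r
∈-map-++-∷⁻ f xs q∈ with ∈-++⁻ (map f xs) q∈
... | inj₁ q∈fxs       = let r , r∈ , q≡fr = ∈-map⁻ f q∈fxs in inj₂ (r , ∈-++⁺ˡ r∈ , q≡fr)
... | inj₂ (here q≡p)  = inj₁ q≡p
... | inj₂ (there q∈fys) = let r , r∈ , q≡fr = ∈-map⁻ f q∈fys in inj₂ (r , ∈-++⁺ʳ xs (there r∈) , q≡fr)

lhs-map₂ : ∀ (f : PT → PT) (xs : List Binding) → map proj₁ (map (map₂ f) xs) ≡ map proj₁ xs
lhs-map₂ f []       = refl
lhs-map₂ f (x ∷ xs) = cong (proj₁ x ∷_) (lhs-map₂ f xs)

lhs-map₂-++-∷ : ∀ (f : PT → PT) xs (p : Binding) ys →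
  map proj₁ (map (map₂ f) xs ++ p ∷ map (map₂ f) ys) ≡ map proj₁ (xs ++ p ∷ ys)
lhs-map₂-++-∷ f xs p ys = begin
  map proj₁ (map (map₂ f) xs ++ p ∷ map (map₂ f) ys)
    ≡⟨ map-++ proj₁ (map (map₂ f) xs) _ ⟩
  map proj₁ (map (map₂ f) xs) ++ proj₁ p ∷ map proj₁ (map (map₂ f) ys)
    ≡⟨ cong₂ (λ us vs → us ++ proj₁ p ∷ vs) (lhs-map₂ f xs) (lhs-map₂ f ys) ⟩
  map proj₁ xs ++ proj₁ p ∷ map proj₁ ys
    ≡⟨ map-++ proj₁ xs _ ⟨
  map proj₁ (xs ++ p ∷ ys) ∎
  where open ≡-Reasoning

distinct-++ : ∀ {ps qs} → Distinct ps → Distinct qs →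
  (∀ {p q} → p ∈ ps → q ∈ qs → proj₁ p ≢ proj₁ q) → Distinct (ps ++ qs)
distinct-++ {ps} {qs} dps dqs apart =
  ≡.subst Unique (sym (map-++ proj₁ ps qs)) (Unique.++⁺ dps dqs disjoint)
  where
  disjoint : ∀ {a} → ¬ (a ∈ map proj₁ ps × a ∈ map proj₁ qs)
  disjoint (a∈ps , a∈qs) with ∈-map⁻ proj₁ a∈ps | ∈-map⁻ proj₁ a∈qs
  ... | p , p∈ , refl | q , q∈ , a≡q = apart p∈ q∈ a≡q

distinct-pivot : ∀ xs {p ys} → Distinct (xs ++ p ∷ ys) → All (λ q → proj₁ p ≢ proj₁ q) (xs ++ ys)
distinct-pivot []       (p≢ys ∷ _)   = All.map⁻ p≢ys
distinct-pivot (x ∷ xs) (x≢rest ∷ d) =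
  ≢-sym (All.lookup (All.map⁻ x≢rest) (∈-insert xs)) ∷ distinct-pivot xs d

data Redex (_occursᴱ_ : ℕ → Eqn → Set) (E : List Eqn) : Set where
  trivial      : ∀ {A} → (A ≐ A) ∈ E → Redex _occursᴱ_ E
  non-variable : ∀ {e} → e ∈ E → (∀ a B → e ≢ (tv a ≐ B)) → Redex _occursᴱ_ E
  eliminable   : ∀ xs a A ys → E ≡ xs ++ (tv a ≐ A) ∷ ys → Any (a occursᴱ_) (xs ++ ys) →
                 Redex _occursᴱ_ E

→u-redex : ∀ {E E′} → E →u E′ → Redex _∈E_ E
→u-redex (erase xs ys A)             = trivial (∈-insert xs)
→u-redex (swap xs ys σ A a)          = non-variable (∈-insert xs) λ _ _ ()
→u-redex (arrow xs ys σ A τ B)       = non-variable (∈-insert xs) λ _ _ ()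
→u-redex (list xs ys σ τ _)          = non-variable (∈-insert xs) λ _ _ ()
→u-redex (subs xs ys a A _ occurs)   = eliminable xs a A ys refl occurs

→o-redex : ∀ {E E′} → E →o E′ → Redex _∈OE_ E
→o-redex (erase xs ys A)             = trivial (∈-insert xs)
→o-redex (swap xs ys σ A a)          = non-variable (∈-insert xs) λ _ _ ()
→o-redex (arrow xs ys σ A τ B)       = non-variable (∈-insert xs) λ _ _ ()
→o-redex (list xs ys σ τ _)          = non-variable (∈-insert xs) λ _ _ ()
→o-redex (subs xs ys a A _ occurs)   = eliminable xs a A ys refl occurs

-- →u and →o differ only in which occurrences count and which get substituted.
record UnificationRules : Set₁ where
  field
    _occurs-in_   : ℕ → PT → Set
    _occurs-in?_  : ∀ a A → Dec (a occurs-in A)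
    occurs⇒∈V     : ∀ {a A} → a occurs-in A → a ∈V A
    occurs-in-tv  : ∀ {a} → a occurs-in tv a
    _occurs-inᴱ_  : ℕ → Eqn → Set
    occurs-inᴱ⁺   : ∀ {a C D} → a occurs-in C ⊎ a occurs-in D → a occurs-inᴱ (C ≐ D)
    occurs-inᴱ⁻   : ∀ {a C D} → a occurs-inᴱ (C ≐ D) → a occurs-in C ⊎ a occurs-in D
    sub           : ℕ → PT → PT → PT
    sub-tv        : ∀ {a c} B → a ≢ c → sub a B (tv c) ≡ tv c
    ∈V-sub⁻       : ∀ {a B b} C → b ∈V sub a B C → b ∈V C ⊎ (a ∈V C × b ∈V B)
    occurs-sub⁻   : ∀ {a B b} C → b occurs-in sub a B C → (b ≢ a × b occurs-in C) ⊎ b occurs-in B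
    subᴱ          : ℕ → PT → Eqn → Eqn
    subᴱ-≐        : ∀ a B C D → subᴱ a B (C ≐ D) ≡ (sub a B C ≐ sub a B D)
    _⟶_           : List Eqn → List Eqn → Set
    subs-step     : ∀ xs ys a A → ¬ (a ∈V A) → Any (a occurs-inᴱ_) (xs ++ ys) →
                    (xs ++ (tv a ≐ A) ∷ ys) ⟶ (map (subᴱ a A) xs ++ (tv a ≐ A) ∷ map (subᴱ a A) ys)
    step-redex    : ∀ {E E′} → E ⟶ E′ → Redex _occurs-inᴱ_ E

→u-rules : UnificationRules
→u-rules = record
  { _occurs-in_  = _∈V_
  ; _occurs-in?_ = _∈V?_
  ; occurs⇒∈V    = id
  ; occurs-in-tv = here
  ; _occurs-inᴱ_ = _∈E_
  ; occurs-inᴱ⁺  = id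
  ; occurs-inᴱ⁻  = id
  ; sub          = subst
  ; sub-tv       = subst-tv
  ; ∈V-sub⁻      = λ C → Sum.map₁ proj₂ ∘ ∈V-subst⁻ C
  ; occurs-sub⁻  = λ C → Sum.map₂ proj₂ ∘ ∈V-subst⁻ C
  ; subᴱ         = substEq
  ; subᴱ-≐       = λ _ _ _ _ → refl
  ; _⟶_          = _→u_
  ; subs-step    = subs
  ; step-redex   = →u-redex
  }

→o-rules : UnificationRules
→o-rules = record
  { _occurs-in_  = _∈O_
  ; _occurs-in?_ = _∈O?_
  ; occurs⇒∈V    = ∈O⇒∈V
  ; occurs-in-tv = here
  ; _occurs-inᴱ_ = _∈OE_
  ; occurs-inᴱ⁺  = id
  ; occurs-inᴱ⁻  = id
  ; sub          = substO
  ; sub-tv       = substO-tv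
  ; ∈V-sub⁻      = ∈V-substO⁻
  ; occurs-sub⁻  = ∈O-substO⁻
  ; subᴱ         = substOEq
  ; subᴱ-≐       = λ _ _ _ _ → refl
  ; _⟶_          = _→o_
  ; subs-step    = subs
  ; step-redex   = →o-redex
  }

module Elimination (R : UnificationRules) where
  open UnificationRules R

  Free : ℕ → List Binding → Set
  Free c L = ∀ {q} → q ∈ L → ¬ (c occurs-in proj₂ q)

  Eliminated : List Binding → Set
  Eliminated L = ∀ {p} → p ∈ L → Free (proj₁ p) L

  _[_≔_] : List Binding → ℕ → PT → List Binding
  ps [ a ≔ B ] = map (map₂ (sub a B)) ps

  tv-occurs⁻ : ∀ {a c} → a occurs-in tv c → a ≡ c
  tv-occurs⁻ a∈c with occurs⇒∈V a∈c
  ... | here = refl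

  no-redex : ∀ {L} → Distinct L → Eliminated L → ¬ Redex _occurs-inᴱ_ (map toEq L)
  no-redex _ eliminated (trivial A≐A∈) with ∈-map⁻ toEq A≐A∈
  ... | (c , _) , p∈ , refl = eliminated p∈ p∈ occurs-in-tv
  no-redex _ _ (non-variable e∈ not-variable) with ∈-map⁻ toEq e∈
  ... | (c , C) , _ , refl = not-variable c C refl
  no-redex {L} distinct eliminated (eliminable xs a A ys E≡ occurs) with map-≡-++-∷⁻ toEq L E≡
  ... | ps₁ , (c , C) , ps₂ , refl , refl , refl , refl
    with find (Any.map⁻ (≡.subst (Any _) (sym (map-++ toEq ps₁ ps₂)) occurs))
  ...   | q , q∈ , a-occurs =
    [ All.lookup (distinct-pivot ps₁ distinct) q∈ ∘ tv-occurs⁻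
    , eliminated (∈-insert ps₁) (++⁺ʳ ps₁ (xs⊆x∷xs ps₂ _) q∈)
    ]′ (occurs-inᴱ⁻ a-occurs)

  irreducible : ∀ {L} → Distinct L → Eliminated L → ∀ E′ → ¬ (map toEq L ⟶ E′)
  irreducible distinct eliminated _ = no-redex distinct eliminated ∘ step-redex

  occurs-sub-free : ∀ {a B c} C → ¬ (c occurs-in B) → c ≡ a ⊎ ¬ (c occurs-in C) →
                    ¬ (c occurs-in sub a B C)
  occurs-sub-free C c∉B c-ok c∈ with occurs-sub⁻ C c∈
  ... | inj₁ (c≢a , c∈C) = [ c≢a , (λ c∉C → c∉C c∈C) ]′ c-ok
  ... | inj₂ c∈B         = c∉B c∈B

  free-sub : ∀ xs {a B ys c} → ¬ (a ∈V B) → c ≡ a ⊎ Free c (xs ++ (a , B) ∷ ys) →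
             Free c (xs [ a ≔ B ] ++ (a , B) ∷ ys [ a ≔ B ])
  free-sub xs {a} {B} {ys} {c} a∉B c-ok = free
    where
    c∉B : ¬ (c occurs-in B)
    c∉B = [ (λ { refl → a∉B ∘ occurs⇒∈V }) , (λ c-free → c-free (∈-insert xs)) ]′ c-ok

    free : Free c (xs [ a ≔ B ] ++ (a , B) ∷ ys [ a ≔ B ])
    free q∈ with ∈-map-++-∷⁻ _ xs q∈
    ... | inj₁ refl            = c∉B
    ... | inj₂ (r , r∈ , refl) = occurs-sub-free (proj₂ r) c∉B (Sum.map₂ (λ c-free → c-free r∈) c-ok)

  free-absent : ∀ xs {a B ys} → ¬ (a ∈V B) → ¬ Any (λ q → a occurs-in proj₂ q) (xs ++ ys) →
                Free a (xs ++ (a , B) ∷ ys)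
  free-absent xs a∉B absent q∈ with ∈-++⁻ xs q∈
  ... | inj₁ q∈xs         = absent ∘ lose (∈-++⁺ˡ q∈xs)
  ... | inj₂ (here refl)  = a∉B ∘ occurs⇒∈V
  ... | inj₂ (there q∈ys) = absent ∘ lose (∈-++⁺ʳ xs q∈ys)

  ranked-sub : ∀ xs {a B ys rk} → Ranked rk (xs ++ (a , B) ∷ ys) →
               Ranked rk (xs [ a ≔ B ] ++ (a , B) ∷ ys [ a ≔ B ])
  ranked-sub xs ranked q∈ b∈ with ∈-map-++-∷⁻ _ xs q∈
  ... | inj₁ refl = ranked (∈-insert xs) b∈
  ... | inj₂ ((c , C) , r∈ , refl) with ∈V-sub⁻ C b∈
  ...   | inj₁ b∈C         = ranked r∈ b∈C
  ...   | inj₂ (a∈C , b∈B) = <-trans (ranked (∈-insert xs) b∈B) (ranked r∈ a∈C)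

  lhs-sub : ∀ xs {a B ys} →
            map proj₁ (xs [ a ≔ B ] ++ (a , B) ∷ ys [ a ≔ B ]) ≡ map proj₁ (xs ++ (a , B) ∷ ys)
  lhs-sub xs {a} {B} {ys} = lhs-map₂-++-∷ (sub a B) xs (a , B) ys

  subᴱ-toEq : ∀ {a B} qs → All (λ q → a ≢ proj₁ q) qs →
              map (subᴱ a B) (map toEq qs) ≡ map toEq (qs [ a ≔ B ])
  subᴱ-toEq []             []            = refl
  subᴱ-toEq {a} {B} ((c , C) ∷ qs) (a≢c ∷ a∉qs) =
    cong₂ _∷_ (trans (subᴱ-≐ a B (tv c) C) (cong (_≐ sub a B C) (sub-tv B a≢c))) (subᴱ-toEq qs a∉qs)

  eliminate-step : ∀ xs {a B ys} → Distinct (xs ++ (a , B) ∷ ys) → ¬ (a ∈V B) →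
                   Any (λ q → a occurs-in proj₂ q) (xs ++ ys) →
                   map toEq (xs ++ (a , B) ∷ ys) ⟶ map toEq (xs [ a ≔ B ] ++ (a , B) ∷ ys [ a ≔ B ])
  eliminate-step xs {a} {B} {ys} distinct a∉B occurs =
    ≡.subst₂ _⟶_ (sym (map-++ toEq xs _)) substituted
      (subs-step (map toEq xs) (map toEq ys) a B a∉B occursᴱ)
    where
    open ≡-Reasoning
    a-fresh : All (λ q → a ≢ proj₁ q) xs × All (λ q → a ≢ proj₁ q) ys
    a-fresh = All.++⁻ xs (distinct-pivot xs distinct)

    substituted : map (subᴱ a B) (map toEq xs) ++ (tv a ≐ B) ∷ map (subᴱ a B) (map toEq ys)
                ≡ map toEq (xs [ a ≔ B ] ++ (a , B) ∷ ys [ a ≔ B ])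
    substituted = begin
      map (subᴱ a B) (map toEq xs) ++ (tv a ≐ B) ∷ map (subᴱ a B) (map toEq ys)
        ≡⟨ cong₂ (λ us vs → us ++ (tv a ≐ B) ∷ vs)
                 (subᴱ-toEq xs (proj₁ a-fresh)) (subᴱ-toEq ys (proj₂ a-fresh)) ⟩
      map toEq (xs [ a ≔ B ]) ++ (tv a ≐ B) ∷ map toEq (ys [ a ≔ B ])
        ≡⟨ map-++ toEq (xs [ a ≔ B ]) _ ⟨
      map toEq (xs [ a ≔ B ] ++ (a , B) ∷ ys [ a ≔ B ]) ∎

    occursᴱ : Any (a occurs-inᴱ_) (map toEq xs ++ map toEq ys)
    occursᴱ = ≡.subst (Any _) (map-++ toEq xs ys) (Any.map⁺ (Any.map (occurs-inᴱ⁺ ∘ inj₂) occurs))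

  Pending : List ℕ → List Binding → Set
  Pending as L = ∀ {c} → c ∈ map proj₁ L → c ∈ as ⊎ Free c L

  pending-next : ∀ {a as L L′} → map proj₁ L′ ≡ map proj₁ L → (a ∈ map proj₁ L′ → Free a L′) →
                 (∀ {c} → Free c L → Free c L′) → Pending (a ∷ as) L → Pending as L′
  pending-next lhs≡ free-a preserve pending c∈ with pending (≡.subst (_ ∈_) lhs≡ c∈)
  ... | inj₁ (here refl)  = inj₂ (free-a c∈)
  ... | inj₁ (there c∈as) = inj₁ c∈as
  ... | inj₂ c-free       = inj₂ (preserve c-free)

  record Solution (rk : ℕ → ℕ) (L : List Binding) : Set where
    constructor solution
    field
      solved     : List Binding
      steps      : Star _⟶_ (map toEq L) (map toEq solved)
      distinct   : Distinct solved
      ranked     : Ranked rk solved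
      eliminated : Eliminated solved

  _◅ˢ_ : ∀ {rk L L′} → map toEq L ⟶ map toEq L′ → Solution rk L′ → Solution rk L
  st ◅ˢ solution ps sts distinct ranked eliminated = solution ps (st ◅ sts) distinct ranked eliminated

  mutual
    eliminate : ∀ {rk} as L → Distinct L → Ranked rk L → Pending as L → Solution rk L
    eliminate [] L distinct ranked pending =
      solution L ε distinct ranked (λ p∈ → [ (λ ()) , id ]′ (pending (∈-map⁺ proj₁ p∈)))
    eliminate (a ∷ as) L distinct ranked pending with any? (a ≟_) (map proj₁ L)
    ... | no a∉L = eliminate as L distinct ranked (pending-next refl (⊥-elim ∘ a∉L) id pending)
    ... | yes a∈L with ∈-map⁻ proj₁ a∈L
    ...   | (_ , B) , p∈L , refl with ∈-∃++ p∈L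
    ...     | xs , ys , refl =
      eliminate-at as xs B ys (ranked⇒∉rhs ranked (∈-insert xs)) distinct ranked pending

    eliminate-at : ∀ {rk} as xs {a} B ys → ¬ (a ∈V B) → Distinct (xs ++ (a , B) ∷ ys) →
                   Ranked rk (xs ++ (a , B) ∷ ys) → Pending (a ∷ as) (xs ++ (a , B) ∷ ys) →
                   Solution rk (xs ++ (a , B) ∷ ys)
    eliminate-at as xs {a} B ys a∉B distinct ranked pending
      with any? (λ q → a occurs-in? proj₂ q) (xs ++ ys)
    ... | no absent =
      eliminate as _ distinct ranked (pending-next refl (λ _ → free-absent xs a∉B absent) id pending)
    ... | yes occurs =
      eliminate-step xs distinct a∉B occurs ◅ˢ
      eliminate as _ (≡.subst Unique (sym (lhs-sub xs)) distinct) (ranked-sub xs ranked)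
        (pending-next (lhs-sub xs) (λ _ → free-sub xs a∉B (inj₁ refl)) (free-sub xs a∉B ∘ inj₂) pending)

  solve : ∀ {rk L} → Distinct L → Ranked rk L → Solution rk L
  solve {L = L} distinct ranked = eliminate (map proj₁ L) L distinct ranked inj₁

module O = Elimination →o-rules
module U = Elimination →u-rules

NotAbstraction : Term → Set
NotAbstraction (lam _ _) = ⊥
NotAbstraction _         = ⊤

absBinding : PDResult → List PT → Binding
absBinding r []          = suc (next r) , [ tv (next r) ] ⇒ tv (typ r)
absBinding r σ@(_ ∷ _)   = next r , σ ⇒ tv (typ r)

system : Term → ℕ → List Binding
system (var x)   n = []
system (app M N) n =
  system M n ++ system N (next r₁) ++ [ (typ r₁ , [ tv (typ r₂) ] ⇒ tv (next r₂)) ]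
  where
  r₁ : PDResult
  r₁ = pdmin M n
  r₂ : PDResult
  r₂ = pdmin N (next r₁)
system (lam x M) n = system M n ++ [ absBinding (pdmin M n) (env (pdmin M n) x) ]

toEq-snoc : ∀ {E S} p → E ≡ map toEq S → E ++ [ toEq p ] ≡ map toEq (S ++ [ p ])
toEq-snoc {S = S} p refl = sym (map-++ toEq S [ p ])

eqns-system : ∀ M n → eqns (pdmin M n) ≡ map toEq (system M n)
eqns-system (var x)   n = refl
eqns-system (app M N) n =
  trans (cong₂ _++_ (eqns-system M n) (toEq-snoc _ (eqns-system N _))) (sym (map-++ toEq (system M n) _))
eqns-system (lam x M) n with env (pdmin M n) x
... | []    = toEq-snoc _ (eqns-system M n)
... | _ ∷ _ = toEq-snoc _ (eqns-system M n)

Within : ℕ → ℕ → ℕ → Set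
Within n m b = n ≤ b × b < m

within-mono : ∀ {n n′ m m′ b} → n′ ≤ n → m ≤ m′ → Within n m b → Within n′ m′ b
within-mono n′≤n m≤m′ (n≤b , b<m) = ≤-trans n′≤n n≤b , <-≤-trans b<m m≤m′

∈-++-++-[]⁻ : ∀ {A : Set} xs ys {p q : A} → q ∈ xs ++ ys ++ [ p ] → q ∈ xs ⊎ q ∈ ys ⊎ q ≡ p
∈-++-++-[]⁻ xs ys q∈ with ∈-++⁻ xs q∈
... | inj₁ q∈xs = inj₁ q∈xs
... | inj₂ q∈ys++p with ∈-++⁻ ys q∈ys++p
...   | inj₁ q∈ys        = inj₂ (inj₁ q∈ys)
...   | inj₂ (here q≡p) = inj₂ (inj₂ q≡p)

absBinding-next≤ : ∀ r σ → next r ≤ proj₁ (absBinding r σ)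
absBinding-next≤ r []      = n≤1+n (next r)
absBinding-next≤ r (_ ∷ _) = ≤-refl

absBinding-rhs : ∀ {n} r σ → Within n (next r) (typ r) →
  (∀ {A} → A ∈ σ → ∀ {b} → b ∈V A → Within n (next r) b) →
  ∀ {b} → b ∈V proj₂ (absBinding r σ) → Within n (proj₁ (absBinding r σ)) b
absBinding-rhs r [] (n≤t , t<m) _ (dom (here here)) = ≤-trans n≤t (<⇒≤ t<m) , n<1+n (next r)
absBinding-rhs r [] t-within _ (cod here)            = within-mono ≤-refl (n≤1+n (next r)) t-within
absBinding-rhs r (_ ∷ _) _ σ-within (dom b∈σ)        = let A , A∈ , b∈A = find b∈σ in σ-within A∈ b∈A
absBinding-rhs r (_ ∷ _) t-within _ (cod here)       = t-within

record Scoped (n : ℕ) (r : PDResult) (S : List Binding) : Set where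
  field
    typ-within : Within n (next r) (typ r)
    env-within : ∀ y {A} → A ∈ env r y → ∀ {b} → b ∈V A → Within n (next r) b
    lhs-within : ∀ {p} → p ∈ S → Within n (next r) (proj₁ p)
    rhs-within : ∀ {p} → p ∈ S → ∀ {b} → b ∈V proj₂ p → Within n (next r) b

  n<next : n < next r
  n<next = ≤-<-trans (proj₁ typ-within) (proj₂ typ-within)

∈-remove⁻ : ∀ x Γ y {A} → A ∈ remove x Γ y → A ∈ Γ y
∈-remove⁻ x Γ y A∈ with x ≟ y
... | no _ = A∈

scoped-abs : ∀ {n S} r σ → Scoped n r S → (∀ {A} → A ∈ σ → ∀ {b} → b ∈V A → Within n (next r) b) →
  ∀ Γ E → (∀ y {A} → A ∈ Γ y → A ∈ env r y) →
  Scoped n (result (proj₁ (absBinding r σ)) Γ E (suc (proj₁ (absBinding r σ)))) (S ++ [ absBinding r σ ])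
scoped-abs {n} {S} r σ r-scoped σ-within Γ E Γ⊆ = record
  { typ-within = typ-within
  ; env-within = λ y A∈ b∈ → old (R.env-within y (Γ⊆ y A∈) b∈)
  ; lhs-within = λ p∈ → [ old ∘ R.lhs-within , (λ { (here refl) → typ-within }) ]′ (∈-++⁻ S p∈)
  ; rhs-within = rhs-within
  }
  where
  module R = Scoped r-scoped
  b₀ : ℕ
  b₀ = proj₁ (absBinding r σ)

  typ-within : Within n (suc b₀) b₀
  typ-within = ≤-trans (<⇒≤ R.n<next) (absBinding-next≤ r σ) , n<1+n b₀

  old : ∀ {b} → Within n (next r) b → Within n (suc b₀) b
  old = within-mono ≤-refl (≤-trans (absBinding-next≤ r σ) (n≤1+n b₀))

  rhs-within : ∀ {p} → p ∈ S ++ [ absBinding r σ ] → ∀ {b} → b ∈V proj₂ p → Within n (suc b₀) b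
  rhs-within p∈ b∈ with ∈-++⁻ S p∈
  ... | inj₁ p∈S        = old (R.rhs-within p∈S b∈)
  ... | inj₂ (here refl) = within-mono ≤-refl (n≤1+n b₀) (absBinding-rhs r σ R.typ-within σ-within b∈)

scoped : ∀ M n → Scoped n (pdmin M n) (system M n)
scoped (var x) n = record
  { typ-within = ≤-refl , n<1+n n
  ; env-within = env-within
  ; lhs-within = λ ()
  ; rhs-within = λ ()
  }
  where
  env-within : ∀ y {A} → A ∈ env (pdmin (var x) n) y → ∀ {b} → b ∈V A → Within n (suc n) b
  env-within y A∈ with x ≟ y
  env-within y (here refl) | yes _ = λ { here → ≤-refl , n<1+n n }
  env-within y ()          | no _
scoped (app M N) n = record
  { typ-within = n≤m₂ , n<1+n m₂
  ; env-within = λ y A∈ b∈ → [ (λ A∈₁ → in₁ (S₁.env-within y A∈₁ b∈))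
                             , (λ A∈₂ → in₂ (S₂.env-within y A∈₂ b∈)) ]′ (∈-++⁻ (env r₁ y) A∈)
  ; lhs-within = lhs-within
  ; rhs-within = rhs-within
  }
  where
  r₁ : PDResult
  r₁ = pdmin M n
  m₁ : ℕ
  m₁ = next r₁
  r₂ : PDResult
  r₂ = pdmin N m₁
  m₂ : ℕ
  m₂ = next r₂
  module S₁ = Scoped (scoped M n)
  module S₂ = Scoped (scoped N m₁)

  n≤m₂ : n ≤ m₂
  n≤m₂ = <⇒≤ (<-trans S₁.n<next S₂.n<next)

  in₁ : ∀ {b} → Within n m₁ b → Within n (suc m₂) b
  in₁ = within-mono ≤-refl (<⇒≤ (m<n⇒m<1+n S₂.n<next))

  in₂ : ∀ {b} → Within m₁ m₂ b → Within n (suc m₂) b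
  in₂ = within-mono (<⇒≤ S₁.n<next) (n≤1+n m₂)

  lhs-within : ∀ {p} → p ∈ system (app M N) n → Within n (suc m₂) (proj₁ p)
  lhs-within p∈ with ∈-++-++-[]⁻ (system M n) (system N m₁) p∈
  ... | inj₁ p∈₁        = in₁ (S₁.lhs-within p∈₁)
  ... | inj₂ (inj₁ p∈₂) = in₂ (S₂.lhs-within p∈₂)
  ... | inj₂ (inj₂ refl) = in₁ S₁.typ-within

  rhs-within : ∀ {p} → p ∈ system (app M N) n → ∀ {b} → b ∈V proj₂ p → Within n (suc m₂) b
  rhs-within p∈ b∈ with ∈-++-++-[]⁻ (system M n) (system N m₁) p∈
  rhs-within p∈ b∈                | inj₁ p∈₁         = in₁ (S₁.rhs-within p∈₁ b∈)
  rhs-within p∈ b∈                | inj₂ (inj₁ p∈₂)  = in₂ (S₂.rhs-within p∈₂ b∈)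
  rhs-within p∈ (dom (here here)) | inj₂ (inj₂ refl) = in₂ S₂.typ-within
  rhs-within p∈ (cod here)        | inj₂ (inj₂ refl) = n≤m₂ , n<1+n m₂
scoped (lam x M) n with env (pdmin M n) x in x↦σ
... | []    = scoped-abs (pdmin M n) [] (scoped M n) (λ ()) _ _ (λ _ → id)
... | A ∷ σ = scoped-abs (pdmin M n) (A ∷ σ) (scoped M n) σ-within _ _ (∈-remove⁻ x (env (pdmin M n)))
  where
  σ-within : ∀ {B} → B ∈ A ∷ σ → ∀ {b} → b ∈V B → Within n (next (pdmin M n)) b
  σ-within B∈ = Scoped.env-within (scoped M n) x (≡.subst (_ ∈_) (sym x↦σ) B∈)

below : ℕ → (ℕ → ℕ) → (ℕ → ℕ) → ℕ → ℕ
below m f g v with v <? m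
... | yes _ = f v
... | no _  = g v

below-< : ∀ m f g {v} → v < m → below m f g v ≡ f v
below-< m f g {v} v<m with v <? m
... | yes _   = refl
... | no v≮m = ⊥-elim (v≮m v<m)

below-≥ : ∀ m f g {v} → m ≤ v → below m f g v ≡ g v
below-≥ m f g {v} m≤v with v <? m
... | yes v<m = ⊥-elim (<-irrefl refl (<-≤-trans v<m m≤v))
... | no _    = refl

below-bounded : ∀ m {f g k} → (∀ v → f v < k) → (∀ v → g v < k) → ∀ v → below m f g v < k
below-bounded m f<k g<k v with v <? m
... | yes _ = f<k v
... | no _  = g<k v

record Ranking (S : List Binding) : Set where
  field
    rank       : ℕ → ℕ
    bound      : ℕ
    rank<bound : ∀ v → rank v < bound
    ranked     : Ranked rank S

system-ranking : ∀ M n → Ranking (system M n)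
system-ranking (var x) n = record { rank = λ _ → 0 ; bound = 1 ; rank<bound = λ _ → s≤s z≤n ; ranked = λ () }
system-ranking (app M N) n = record
  { rank       = rank
  ; bound      = R₂.bound + R₁.bound
  ; rank<bound = below-bounded m₁ (λ v → +-monoʳ-< R₂.bound (R₁.rank<bound v))
                                  (λ v → <-≤-trans (R₂.rank<bound v) (m≤m+n R₂.bound R₁.bound))
  ; ranked     = ranked
  }
  where
  m₁ : ℕ
  m₁ = next (pdmin M n)
  module S₁ = Scoped (scoped M n)
  module S₂ = Scoped (scoped N m₁)
  module R₁ = Ranking (system-ranking M n)
  module R₂ = Ranking (system-ranking N m₁)
  open ≤-Reasoning

  -- The equation added by (app) has its left side, the type of M, in M's range and
  -- its right side in N's range; so M's ranks are shifted above all of N's.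
  shifted : ℕ → ℕ
  shifted v = R₂.bound + R₁.rank v

  rank : ℕ → ℕ
  rank = below m₁ shifted R₂.rank

  rank-of-M : ∀ {v} → Within n m₁ v → rank v ≡ R₂.bound + R₁.rank v
  rank-of-M = below-< m₁ shifted R₂.rank ∘ proj₂

  rank-of-N : ∀ {v} → m₁ ≤ v → rank v ≡ R₂.rank v
  rank-of-N = below-≥ m₁ shifted R₂.rank

  ranked : Ranked rank (system (app M N) n)
  ranked p∈ b∈ with ∈-++-++-[]⁻ (system M n) (system N m₁) p∈
  ranked p∈ b∈ | inj₁ p∈₁ = begin-strict
    rank _                    ≡⟨ rank-of-M (S₁.rhs-within p∈₁ b∈) ⟩
    R₂.bound + R₁.rank _      <⟨ +-monoʳ-< R₂.bound (R₁.ranked p∈₁ b∈) ⟩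
    R₂.bound + R₁.rank _      ≡⟨ rank-of-M (S₁.lhs-within p∈₁) ⟨
    rank _                    ∎
  ranked p∈ b∈ | inj₂ (inj₁ p∈₂) = begin-strict
    rank _                    ≡⟨ rank-of-N (proj₁ (S₂.rhs-within p∈₂ b∈)) ⟩
    R₂.rank _                 <⟨ R₂.ranked p∈₂ b∈ ⟩
    R₂.rank _                 ≡⟨ rank-of-N (proj₁ (S₂.lhs-within p∈₂)) ⟨
    rank _                    ∎
  ranked p∈ {b} b∈ | inj₂ (inj₂ refl) = begin-strict
    rank b                    ≡⟨ rank-of-N (m₁≤b b∈) ⟩
    R₂.rank b                 <⟨ R₂.rank<bound b ⟩
    R₂.bound                  ≤⟨ m≤m+n R₂.bound _ ⟩
    R₂.bound + R₁.rank _      ≡⟨ rank-of-M S₁.typ-within ⟨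
    rank _                    ∎
    where
    m₁≤b : ∀ {b} → b ∈V ([ tv (typ (pdmin N m₁)) ] ⇒ tv (next (pdmin N m₁))) → m₁ ≤ b
    m₁≤b (dom (here here)) = proj₁ S₂.typ-within
    m₁≤b (cod here)        = <⇒≤ S₂.n<next
system-ranking (lam x M) n = record
  { rank       = rank
  ; bound      = suc R.bound
  ; rank<bound = below-bounded a₀ (λ v → m<n⇒m<1+n (R.rank<bound v)) (λ _ → n<1+n R.bound)
  ; ranked     = ranked
  }
  where
  r : PDResult
  r = pdmin M n
  a₀ : ℕ
  a₀ = proj₁ (absBinding r (env r x))
  module S = Scoped (scoped M n)
  module R = Ranking (system-ranking M n)
  open ≤-Reasoning

  top : ℕ → ℕ
  top _ = R.bound

  rank : ℕ → ℕ
  rank = below a₀ R.rank top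

  rank-old : ∀ {v} → v < a₀ → rank v ≡ R.rank v
  rank-old = below-< a₀ R.rank top

  old : ∀ {v} → Within n (next r) v → v < a₀
  old v-within = <-≤-trans (proj₂ v-within) (absBinding-next≤ r (env r x))

  ranked : Ranked rank (system (lam x M) n)
  ranked p∈ b∈ with ∈-++⁻ (system M n) p∈
  ... | inj₁ p∈S = begin-strict
    rank _        ≡⟨ rank-old (old (S.rhs-within p∈S b∈)) ⟩
    R.rank _      <⟨ R.ranked p∈S b∈ ⟩
    R.rank _      ≡⟨ rank-old (old (S.lhs-within p∈S)) ⟨
    rank _        ∎
  ... | inj₂ (here refl) = begin-strict
    rank _        ≡⟨ rank-old (proj₂ (absBinding-rhs r (env r x) S.typ-within (S.env-within x) b∈)) ⟩
    R.rank _      <⟨ R.rank<bound _ ⟩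
    R.bound       ≡⟨ below-≥ a₀ R.rank top ≤-refl ⟨
    rank a₀       ∎

app-head-not-abstraction : ∀ {M N} → BetaNormal (app M N) → NotAbstraction M
app-head-not-abstraction {var _}   _  = tt
app-head-not-abstraction {app _ _} _  = tt
app-head-not-abstraction {lam _ _} nf = nf redex

typ-not-lhs : ∀ M n → NotAbstraction M → ∀ {p} → p ∈ system M n → proj₁ p ≢ typ (pdmin M n)
typ-not-lhs (var x)   n _ ()
typ-not-lhs (app M N) n _ p∈ with ∈-++-++-[]⁻ (system M n) (system N (next (pdmin M n))) p∈
... | inj₁ p∈₁         = <⇒≢ (<-trans (proj₂ (Scoped.lhs-within (scoped M n) p∈₁)) (Scoped.n<next (scoped N _)))
... | inj₂ (inj₁ p∈₂)  = <⇒≢ (proj₂ (Scoped.lhs-within (scoped N _) p∈₂))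
... | inj₂ (inj₂ refl) = <⇒≢ (<-trans (proj₂ (Scoped.typ-within (scoped M n))) (Scoped.n<next (scoped N _)))

system-distinct : ∀ M n → BetaNormal M → Distinct (system M n)
system-distinct (var x)   n _  = []
system-distinct (app M N) n nf =
  distinct-++ (system-distinct M n (nf ∘ inFun))
              (distinct-++ (system-distinct N m₁ (nf ∘ inArg)) ([] ∷ []) N-apart-new)
              M-apart-rest
  where
  m₁ : ℕ
  m₁ = next (pdmin M n)
  module S₁ = Scoped (scoped M n)
  module S₂ = Scoped (scoped N m₁)

  N-apart-new : ∀ {p q} → p ∈ system N m₁ → q ∈ [ (typ (pdmin M n) , _) ] → proj₁ p ≢ proj₁ q
  N-apart-new p∈ (here refl) = ≢-sym (<⇒≢ (<-≤-trans (proj₂ S₁.typ-within) (proj₁ (S₂.lhs-within p∈))))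

  M-apart-rest : ∀ {p q} → p ∈ system M n → q ∈ system N m₁ ++ [ (typ (pdmin M n) , _) ] → proj₁ p ≢ proj₁ q
  M-apart-rest p∈ q∈ with ∈-++⁻ (system N m₁) q∈
  ... | inj₁ q∈₂         = <⇒≢ (<-≤-trans (proj₂ (S₁.lhs-within p∈)) (proj₁ (S₂.lhs-within q∈₂)))
  ... | inj₂ (here refl) = typ-not-lhs M n (app-head-not-abstraction nf) p∈
system-distinct (lam x M) n nf =
  distinct-++ (system-distinct M n (nf ∘ inLam)) ([] ∷ [])
    λ { p∈ (here refl) → <⇒≢ (<-≤-trans (proj₂ (Scoped.lhs-within (scoped M n) p∈))
                                        (absBinding-next≤ (pdmin M n) (env (pdmin M n) x))) }

toEqs-unblocked : ∀ ps → ¬ Blocked (map toEq ps)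
toEqs-unblocked (_ ∷ ps) (here (_ , _ , () , _))
toEqs-unblocked (_ ∷ ps) (there blocked) = toEqs-unblocked ps blocked

eliminated⇒solved : ∀ {L} → Distinct L → U.Eliminated L → Solved (map toEq L)
eliminated⇒solved {L} distinct eliminated = L , refl , distinct , All.tabulate (All.tabulate ∘ eliminated)

corollary4p9 : (M : Term) → BetaNormal M →
    Σ (List Eqn) λ E₁ →
      Star _→o_ (initEqns M) E₁ × IrreducibleO E₁ × ¬ Blocked E₁ ×
      Σ (List Eqn) λ E₂ →
        Star _→u_ E₁ E₂ × IrreducibleU E₂ × Solved E₂
corollary4p9 M nf =
  map toEq O-normal.solved ,
  ≡.subst (λ E → Star _→o_ E (map toEq O-normal.solved)) (sym (eqns-system M 0)) O-normal.steps ,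
  O.irreducible O-normal.distinct O-normal.eliminated ,
  toEqs-unblocked O-normal.solved ,
  map toEq U-normal.solved ,
  U-normal.steps ,
  U.irreducible U-normal.distinct U-normal.eliminated ,
  eliminated⇒solved U-normal.distinct U-normal.eliminated
  where
  module O-normal = O.Solution (O.solve (system-distinct M 0 nf) (Ranking.ranked (system-ranking M 0)))
  module U-normal = U.Solution (U.solve O-normal.distinct O-normal.ranked)
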